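{- Let $2\le p\le k$ be integers. For every word $w\in\{0,1,2,3\}^p$, the fraction of strings $u\in\{0,1,2,3\}^k$ whose minimum $p$-substring equals $w$ is at most $\frac{3k}{4^{p+1}}$; that is, $$\frac{\left|\{u\in\{0,1,2,3\}^k:\ \min_p(u)=w\}\right|}{4^k}\le \frac{3k}{4^{p+1}}.$$
   Context: Strings of equal length over the alphabet $\{0,1,2,3\}$ (ordered $0<1<2<3$) are compared lexicographically. For a string $u$ of length at least $p$, $\min_p(u)$ is the lexicographically smallest length-$p$ substring of $u$ (as a string). The paper phrases the result as: in a random string model, the maximum percentage of distinct $k$-mers covered by one $p$-substring is bounded by $3k/4^{p+1}$. -}

module Defs where

open import Data.Nat using (ℕ; zero; suc)
open import Data.Fin using (Fin)
import Data.Fin as Fin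
open import Data.Bool using (Bool; true; false; if_then_else_)
open import Data.Vec using (Vec; []; _∷_)
open import Data.List using (List; []; _∷_; map; concatMap; length; filter)
open import Data.Maybe using (Maybe; just; nothing)
open import Relation.Nullary using (yes; no)
import Data.Vec.Properties
import Data.List

-- alphabet {0,1,2,3}, ordered 0<1<2<3 (the order of Fin 4)
Σ₄ : Set
Σ₄ = Fin 4

Word : ℕ → Set
Word n = Vec Σ₄ n

lex≤ : ∀ {n} → Word n → Word n → Bool
lex≤ [] [] = true
lex≤ (a ∷ u) (b ∷ v) with a Fin.<? b | a Fin.≟ b
... | yes _ | _ = true
... | no _ | yes _ = lex≤ u v
... | no _ | no _ = false

prefix : (p : ℕ) → ∀ {m} → Word m → Maybe (Word p)
prefix zero u = just []
prefix (suc p) [] = nothing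
prefix (suc p) (a ∷ u) with prefix p u
... | just w = just (a ∷ w)
... | nothing = nothing

substrings : (p : ℕ) → ∀ {m} → Word m → List (Word p)
substrings p [] with prefix p ([] {A = Σ₄})
... | just w = w ∷ []
... | nothing = []
substrings p (a ∷ u) with prefix p (a ∷ u)
... | just w = w ∷ substrings p u
... | nothing = substrings p u

lexMinimum : ∀ {n} → List (Word n) → Maybe (Word n)
lexMinimum [] = nothing
lexMinimum (w ∷ ws) with lexMinimum ws
... | nothing = just w
... | just v = just (if lex≤ w v then w else v)

-- min_p(u): the lexicographically smallest length-p substring of u
-- (nothing iff |u| < p)
minP : (p : ℕ) → ∀ {m} → Word m → Maybe (Word p)
minP p u = lexMinimum (substrings p u)

allWords : (k : ℕ) → List (Word k)
allWords zero = [] ∷ []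
allWords (suc k) = concatMap (λ a → map (a ∷_) (allWords k)) (Data.List.allFin 4)

eqMaybeWord : ∀ {p} → Maybe (Word p) → Maybe (Word p) → Bool
eqMaybeWord nothing nothing = true
eqMaybeWord (just u) (just v) with Data.Vec.Properties.≡-dec Fin._≟_ u v
... | yes _ = true
... | no _ = false
eqMaybeWord _ _ = false

countMin : (k p : ℕ) → Word p → ℕ
countMin k p w = length (filter (λ u → Data.Bool.T? (eqMaybeWord (minP p u) (just w))) (allWords k))

module Submission where

-- If w = min_p(u) then w is a prefix of u, or w occurs in u
-- right after a nonzero letter.  Indeed, take any occurrence of w; if the
-- letter before it is 0, the substring starting one position earlier is
-- 0·w₁…w_{p-1}, which is ≽ w by minimality, and this forces it to equal w;
-- so w also occurs one position earlier, and we move left until we reach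
-- the start of u or a nonzero letter.
--
-- At most 4^(k-p) words begin with w, and splitting on the first
-- letter shows that at most 3(k-p)·4^(k-p-1) words contain w right after a
-- nonzero letter.  With 4 ≤ 3p the union bound gives the theorem.

open import Defs
open import Data.Nat using (ℕ; zero; suc; _+_; _*_; _^_; _∸_; _≤_; _<_; z≤n; s≤s)
open import Data.Nat.Properties
open import Data.Nat.ListAction using (sum)
open import Data.Nat.Tactic.RingSolver using (solve-∀)
open import Data.Bool using (Bool; true; false; T; T?; _∧_; _∨_; if_then_else_)
open import Data.Bool.Properties using (T-∨)
open import Data.Unit using (tt)
open import Data.Empty using (⊥-elim)
open import Data.Fin using (zero; suc)
import Data.Fin as Fin
import Data.Fin.Properties as FinP
open import Data.List using (List; []; _∷_; map; _++_; concatMap; length; filter; allFin)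
open import Data.List.Properties using (length-++; filter-++; map-cong)
open import Data.List.Membership.Propositional using (_∈_)
open import Data.List.Relation.Unary.Any using (here; there)
open import Data.List.Relation.Unary.All as All using (All; []; _∷_)
open import Data.Vec using ([]; _∷_)
import Data.Vec.Properties
open import Data.Maybe using (Maybe; just; nothing)
open import Data.Product using (_×_; _,_; ∃)
open import Data.Sum using (_⊎_; inj₁; inj₂)
open import Function.Bundles using (Equivalence)
open import Relation.Nullary using (yes; no; does; ¬_)
open import Relation.Nullary.Decidable using (dec-true)
open import Relation.Binary using (tri<; tri≈; tri>)
open import Relation.Binary.PropositionalEquality

count : {A : Set} → (A → Bool) → List A → ℕ
count f xs = length (filter (λ x → T? (f x)) xs)

indicator : Bool → ℕ
indicator true = 1
indicator false = 0

count-∷ : {A : Set} (f : A → Bool) (x : A) (xs : List A) →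
  count f (x ∷ xs) ≡ indicator (f x) + count f xs
count-∷ f x xs with f x
... | true = refl
... | false = refl

count-++ : {A : Set} (f : A → Bool) (xs ys : List A) →
  count f (xs ++ ys) ≡ count f xs + count f ys
count-++ f xs ys =
  trans (cong length (filter-++ (λ x → T? (f x)) xs ys)) (length-++ (filter (λ x → T? (f x)) xs))

count-map : {A B : Set} (f : B → Bool) (g : A → B) (xs : List A) →
  count f (map g xs) ≡ count (λ x → f (g x)) xs
count-map f g [] = refl
count-map f g (x ∷ xs) = begin
  count f (map g (x ∷ xs))
    ≡⟨ count-∷ f (g x) (map g xs) ⟩
  indicator (f (g x)) + count f (map g xs)
    ≡⟨ cong (indicator (f (g x)) +_) (count-map f g xs) ⟩
  indicator (f (g x)) + count (λ x → f (g x)) xs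
    ≡⟨ count-∷ (λ x → f (g x)) x xs ⟨
  count (λ x → f (g x)) (x ∷ xs) ∎
  where open ≡-Reasoning

count-concatMap : {A B : Set} (f : B → Bool) (g : A → List B) (xs : List A) →
  count f (concatMap g xs) ≡ sum (map (λ x → count f (g x)) xs)
count-concatMap f g [] = refl
count-concatMap f g (x ∷ xs) =
  trans (count-++ f (g x) (concatMap g xs)) (cong (count f (g x) +_) (count-concatMap f g xs))

count-false : {A : Set} (xs : List A) → count (λ _ → false) xs ≡ 0
count-false [] = refl
count-false (x ∷ xs) = count-false xs

count-guard : {A : Set} (c : Bool) (g : A → Bool) (xs : List A) →
  count (λ x → c ∧ g x) xs ≡ (if c then count g xs else 0)
count-guard true g xs = refl
count-guard false g xs = count-false xs

count-mono : {A : Set} (f g : A → Bool) → (∀ x → T (f x) → T (g x)) → (xs : List A) →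
  count f xs ≤ count g xs
count-mono f g f⇒g [] = z≤n
count-mono f g f⇒g (x ∷ xs) = begin
  count f (x ∷ xs)
    ≡⟨ count-∷ f x xs ⟩
  indicator (f x) + count f xs
    ≤⟨ +-mono-≤ (indicator-mono (f x) (g x) (f⇒g x)) (count-mono f g f⇒g xs) ⟩
  indicator (g x) + count g xs
    ≡⟨ count-∷ g x xs ⟨
  count g (x ∷ xs) ∎
  where
  open ≤-Reasoning
  indicator-mono : ∀ a b → (T a → T b) → indicator a ≤ indicator b
  indicator-mono false b _ = z≤n
  indicator-mono true false a⇒b = ⊥-elim (a⇒b tt)
  indicator-mono true true _ = ≤-refl

count-∨ : {A : Set} (f g : A → Bool) (xs : List A) →
  count (λ x → f x ∨ g x) xs ≤ count f xs + count g xs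
count-∨ f g [] = z≤n
count-∨ f g (x ∷ xs) = begin
  count (λ x → f x ∨ g x) (x ∷ xs)
    ≡⟨ count-∷ (λ x → f x ∨ g x) x xs ⟩
  indicator (f x ∨ g x) + count (λ x → f x ∨ g x) xs
    ≤⟨ +-mono-≤ (indicator-∨ (f x) (g x)) (count-∨ f g xs) ⟩
  (indicator (f x) + indicator (g x)) + (count f xs + count g xs)
    ≡⟨ shuffle (indicator (f x)) (indicator (g x)) (count f xs) (count g xs) ⟩
  (indicator (f x) + count f xs) + (indicator (g x) + count g xs)
    ≡⟨ cong₂ _+_ (count-∷ f x xs) (count-∷ g x xs) ⟨
  count f (x ∷ xs) + count g (x ∷ xs) ∎
  where
  open ≤-Reasoning
  indicator-∨ : ∀ a b → indicator (a ∨ b) ≤ indicator a + indicator b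
  indicator-∨ true b = s≤s z≤n
  indicator-∨ false b = ≤-refl
  shuffle : ∀ a b c d → (a + b) + (c + d) ≡ (a + c) + (b + d)
  shuffle = solve-∀

sum-map-mono : {A : Set} (f g : A → ℕ) → (∀ x → f x ≤ g x) → (xs : List A) →
  sum (map f xs) ≤ sum (map g xs)
sum-map-mono f g f≤g [] = z≤n
sum-map-mono f g f≤g (x ∷ xs) = +-mono-≤ (f≤g x) (sum-map-mono f g f≤g xs)

countWords : (k : ℕ) → (Word k → Bool) → ℕ
countWords k f = count f (allWords k)

sumLetters : (Σ₄ → ℕ) → ℕ
sumLetters g = sum (map g (allFin 4))

countWords-suc : (k : ℕ) (f : Word (suc k) → Bool) →
  countWords (suc k) f ≡ sumLetters (λ a → countWords k (λ v → f (a ∷ v)))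
countWords-suc k f =
  trans (count-concatMap f (λ a → map (a ∷_) (allWords k)) (allFin 4))
        (cong sum (map-cong (λ a → count-map f (a ∷_) (allWords k)) (allFin 4)))

countWords-all : (k : ℕ) → countWords k (λ _ → true) ≡ 4 ^ k
countWords-all zero = refl
countWords-all (suc k) =
  trans (countWords-suc k (λ _ → true)) (cong (λ n → n + (n + (n + (n + 0)))) (countWords-all k))

isPrefix : ∀ {p m} → Word p → Word m → Bool
isPrefix [] u = true
isPrefix (a ∷ w) [] = false
isPrefix (a ∷ w) (b ∷ u) = does (a Fin.≟ b) ∧ isPrefix w u

sumLetters-select : (a : Σ₄) (n : ℕ) → sumLetters (λ b → if does (a Fin.≟ b) then n else 0) ≡ n
sumLetters-select zero n = +-identityʳ n
sumLetters-select (suc zero) n = +-identityʳ n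
sumLetters-select (suc (suc zero)) n = +-identityʳ n
sumLetters-select (suc (suc (suc zero))) n = +-identityʳ n

countWords-isPrefix-∷ : ∀ {p} (k : ℕ) (a : Σ₄) (w : Word p) →
  countWords (suc k) (isPrefix (a ∷ w)) ≡ countWords k (isPrefix w)
countWords-isPrefix-∷ k a w = begin
  countWords (suc k) (isPrefix (a ∷ w))
    ≡⟨ countWords-suc k (isPrefix (a ∷ w)) ⟩
  sumLetters (λ b → count (λ v → does (a Fin.≟ b) ∧ isPrefix w v) (allWords k))
    ≡⟨ cong sum (map-cong (λ b → count-guard (does (a Fin.≟ b)) (isPrefix w) (allWords k)) (allFin 4)) ⟩
  sumLetters (λ b → if does (a Fin.≟ b) then countWords k (isPrefix w) else 0)
    ≡⟨ sumLetters-select a (countWords k (isPrefix w)) ⟩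
  countWords k (isPrefix w) ∎
  where open ≡-Reasoning

countWords-isPrefix : ∀ {p} (k : ℕ) (w : Word p) → countWords k (isPrefix w) * 4 ^ p ≤ 4 ^ k
countWords-isPrefix k [] = ≤-reflexive (trans (*-identityʳ _) (countWords-all k))
countWords-isPrefix zero (a ∷ w) = z≤n
countWords-isPrefix {suc p} (suc k) (a ∷ w) = begin
  countWords (suc k) (isPrefix (a ∷ w)) * (4 * 4 ^ p)
    ≡⟨ cong (_* (4 * 4 ^ p)) (countWords-isPrefix-∷ k a w) ⟩
  countWords k (isPrefix w) * (4 * 4 ^ p)
    ≡⟨ *-comm-4 (countWords k (isPrefix w)) (4 ^ p) ⟩
  4 * (countWords k (isPrefix w) * 4 ^ p)
    ≤⟨ *-monoʳ-≤ 4 (countWords-isPrefix k w) ⟩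
  4 * 4 ^ k ∎
  where
  open ≤-Reasoning
  *-comm-4 : ∀ a b → a * (4 * b) ≡ 4 * (a * b)
  *-comm-4 = solve-∀

countWords-isPrefix-short : ∀ {p} (k : ℕ) (w : Word p) → k < p → countWords k (isPrefix w) ≡ 0
countWords-isPrefix-short zero (a ∷ w) _ = refl
countWords-isPrefix-short (suc k) (a ∷ w) (s≤s k<p) =
  trans (countWords-isPrefix-∷ k a w) (countWords-isPrefix-short k w k<p)

isPrefix-length : ∀ {p m} (w : Word p) (u : Word m) → T (isPrefix w u) → p ≤ m
isPrefix-length [] u _ = z≤n
isPrefix-length (a ∷ w) (b ∷ u) w≤u with does (a Fin.≟ b)
... | true = s≤s (isPrefix-length w u w≤u)

prefix-defined : ∀ p {m} (u : Word m) → p ≤ m → ∃ λ x → prefix p u ≡ just x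
prefix-defined zero u _ = [] , refl
prefix-defined (suc p) (a ∷ u) (s≤s p≤m) with prefix p u | prefix-defined p u p≤m
... | just x | _ = a ∷ x , refl

prefix-isPrefix : ∀ p {m} (u : Word m) (x : Word p) → prefix p u ≡ just x → T (isPrefix x u)
prefix-isPrefix zero u [] _ = tt
prefix-isPrefix (suc p) (a ∷ u) x eq with prefix p u in eq′
prefix-isPrefix (suc p) (a ∷ u) (.a ∷ y) refl | just y =
  subst (λ c → T (c ∧ isPrefix y u)) (sym (dec-true (a Fin.≟ a) refl)) (prefix-isPrefix p u y eq′)

data _≼_ : ∀ {n} → Word n → Word n → Set where
  []≼[] : [] ≼ []
  head< : ∀ {n a b} {u v : Word n} → a Fin.< b → (a ∷ u) ≼ (b ∷ v)
  head≡ : ∀ {n a} {u v : Word n} → u ≼ v → (a ∷ u) ≼ (a ∷ v)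

≼-refl : ∀ {n} (u : Word n) → u ≼ u
≼-refl [] = []≼[]
≼-refl (a ∷ u) = head≡ (≼-refl u)

≼-trans : ∀ {n} {u v x : Word n} → u ≼ v → v ≼ x → u ≼ x
≼-trans []≼[] []≼[] = []≼[]
≼-trans (head< a<b) (head< b<c) = head< (FinP.<-trans a<b b<c)
≼-trans (head< a<b) (head≡ _) = head< a<b
≼-trans (head≡ _) (head< b<c) = head< b<c
≼-trans (head≡ u≼v) (head≡ v≼x) = head≡ (≼-trans u≼v v≼x)

lex≤-true : ∀ {n} (u v : Word n) → T (lex≤ u v) → u ≼ v
lex≤-true [] [] _ = []≼[]
lex≤-true (a ∷ u) (b ∷ v) t with a Fin.<? b | a Fin.≟ b
... | yes a<b | _ = head< a<b
... | no _ | yes refl = head≡ (lex≤-true u v t)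

lex≤-false : ∀ {n} (u v : Word n) → ¬ T (lex≤ u v) → v ≼ u
lex≤-false [] [] f = ⊥-elim (f tt)
lex≤-false (a ∷ u) (b ∷ v) f with a Fin.<? b | a Fin.≟ b
... | yes _ | _ = ⊥-elim (f tt)
... | no _ | yes refl = head≡ (lex≤-false u v f)
... | no a≮b | no a≢b with FinP.<-cmp a b
...   | tri< a<b _ _ = ⊥-elim (a≮b a<b)
...   | tri≈ _ a≡b _ = ⊥-elim (a≢b a≡b)
...   | tri> _ _ b<a = head< b<a

lexMinimum-nothing : ∀ {n} (ws : List (Word n)) → lexMinimum ws ≡ nothing → ws ≡ []
lexMinimum-nothing [] _ = refl
lexMinimum-nothing (w ∷ ws) eq with lexMinimum ws
lexMinimum-nothing (w ∷ ws) () | nothing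
lexMinimum-nothing (w ∷ ws) () | just _

lexMinimum-spec : ∀ {n} (ws : List (Word n)) (m : Word n) → lexMinimum ws ≡ just m →
  m ∈ ws × All (m ≼_) ws
lexMinimum-spec (x ∷ ws) m eq with lexMinimum ws in eq′
lexMinimum-spec (x ∷ ws) m refl | nothing rewrite lexMinimum-nothing ws eq′ =
  here refl , ≼-refl x ∷ []
... | just v with lexMinimum-spec ws v eq′ | lex≤ x v in x≤v
lexMinimum-spec (x ∷ ws) m refl | just v | v∈ws , v≼ws | true =
  here refl , ≼-refl x ∷ All.map (≼-trans (lex≤-true x v (subst T (sym x≤v) tt))) v≼ws
lexMinimum-spec (x ∷ ws) m refl | just v | v∈ws , v≼ws | false =
  there v∈ws , lex≤-false x v (subst T x≤v) ∷ v≼ws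

eqMaybeWord-sound : ∀ {p} (m : Maybe (Word p)) (w : Word p) → T (eqMaybeWord m (just w)) → m ≡ just w
eqMaybeWord-sound (just v) w t with Data.Vec.Properties.≡-dec Fin._≟_ v w
... | yes refl = refl

minP-spec : ∀ {p m} (u : Word m) (w : Word p) → T (eqMaybeWord (minP p u) (just w)) →
  w ∈ substrings p u × All (w ≼_) (substrings p u)
minP-spec {p} u w t = lexMinimum-spec (substrings p u) w (eqMaybeWord-sound (minP p u) w t)

nonzero : Σ₄ → Bool
nonzero zero = false
nonzero (suc _) = true

occursAfterNonzero : ∀ {p m} → Word p → Word m → Bool
occursAfterNonzero w [] = false
occursAfterNonzero w (b ∷ v) = (nonzero b ∧ isPrefix w v) ∨ occursAfterNonzero w v

-- If w is a prefix of u and w ≼ v, where v is the length-p prefix of 0·u,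
-- then v = w.  (v = 0·w₁…w_{p-1}; comparing letter by letter forces w = v.)
shiftedOccurrence : ∀ {p m} (w : Word p) (u : Word m) (v : Word p) →
  T (isPrefix w u) → prefix p (zero ∷ u) ≡ just v → w ≼ v → w ≡ v
shiftedOccurrence [] u [] _ _ _ = refl
shiftedOccurrence {suc q} (a ∷ w) (b ∷ u) v w≤u eq w≼v with a Fin.≟ b
... | yes refl with prefix q (b ∷ u) in eq′
shiftedOccurrence {suc q} (a ∷ w) (a ∷ u) .(zero ∷ y) w≤u refl (head≡ w≼y) | yes refl | just y =
  cong (zero ∷_) (shiftedOccurrence w u y w≤u eq′ w≼y)

module _ {p : ℕ} (w : Word p) where

  extendLeft : ∀ {m} (a : Σ₄) (u : Word m) →
    (a ≡ zero → T (isPrefix w u) → T (isPrefix w (a ∷ u))) →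
    T (isPrefix w u) ⊎ T (occursAfterNonzero w u) →
    T (isPrefix w (a ∷ u)) ⊎ T (occursAfterNonzero w (a ∷ u))
  extendLeft a u _ (inj₂ h) = inj₂ (Equivalence.from T-∨ (inj₂ h))
  extendLeft zero u shift (inj₁ w≤u) = inj₁ (shift refl w≤u)
  extendLeft (suc a) u _ (inj₁ w≤u) = inj₂ (Equivalence.from T-∨ (inj₁ w≤u))

  minimalOccurrence : ∀ {m} (u : Word m) → w ∈ substrings p u → All (w ≼_) (substrings p u) →
    T (isPrefix w u) ⊎ T (occursAfterNonzero w u)
  minimalOccurrence [] w∈ _ with prefix p ([] {A = Σ₄}) in eq
  minimalOccurrence [] (here refl) _ | just x = inj₁ (prefix-isPrefix p [] w eq)
  minimalOccurrence (a ∷ u) w∈ w≼ with prefix p (a ∷ u) in eq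
  minimalOccurrence (a ∷ u) (here refl) _ | just x = inj₁ (prefix-isPrefix p (a ∷ u) w eq)
  minimalOccurrence (a ∷ u) (there w∈) (w≼x ∷ w≼) | just x =
    extendLeft a u shift (minimalOccurrence u w∈ w≼)
    where
    -- x is the substring at position 0 of 0·u; minimality gives w ≼ x.
    shift : a ≡ zero → T (isPrefix w u) → T (isPrefix w (a ∷ u))
    shift refl w≤u = subst (λ v → T (isPrefix v (zero ∷ u)))
      (sym (shiftedOccurrence w u x w≤u eq w≼x)) (prefix-isPrefix p (zero ∷ u) x eq)
  minimalOccurrence (a ∷ u) w∈ w≼ | nothing =
    extendLeft a u impossible (minimalOccurrence u w∈ w≼)
    where
    -- a·u is shorter than p, so u cannot begin with w.
    impossible : a ≡ zero → T (isPrefix w u) → T (isPrefix w (a ∷ u))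
    impossible _ w≤u with prefix-defined p (a ∷ u) (m≤n⇒m≤1+n (isPrefix-length w u w≤u))
    ... | _ , defined with trans (sym eq) defined
    ... | ()

  -- Splitting on the first letter b of a word b·v: w occurs after a nonzero
  -- letter either right after b (three choices of b ≠ 0) or inside v.
  countWords-occurs-suc : (k : ℕ) →
    countWords (suc k) (occursAfterNonzero w) ≤
      3 * countWords k (isPrefix w) + 4 * countWords k (occursAfterNonzero w)
  countWords-occurs-suc k = begin
    countWords (suc k) (occursAfterNonzero w)
      ≡⟨ countWords-suc k (occursAfterNonzero w) ⟩
    sumLetters (λ b → count (λ v → (nonzero b ∧ isPrefix w v) ∨ occursAfterNonzero w v) (allWords k))
      ≤⟨ sum-map-mono _ _ perLetter (allFin 4) ⟩
    sumLetters (λ b → (if nonzero b then P else 0) + H)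
      ≡⟨ collect P H ⟩
    3 * P + 4 * H ∎
    where
    open ≤-Reasoning
    P = countWords k (isPrefix w)
    H = countWords k (occursAfterNonzero w)
    perLetter : ∀ b →
      count (λ v → (nonzero b ∧ isPrefix w v) ∨ occursAfterNonzero w v) (allWords k) ≤
        (if nonzero b then P else 0) + H
    perLetter b = ≤-trans (count-∨ _ (occursAfterNonzero w) (allWords k))
      (≤-reflexive (cong (_+ H) (count-guard (nonzero b) (isPrefix w) (allWords k))))
    collect : ∀ P H → (0 + H) + ((P + H) + ((P + H) + ((P + H) + 0))) ≡ 3 * P + 4 * H
    collect = solve-∀

  countWords-occurs-short : (k : ℕ) → k ≤ p → countWords k (occursAfterNonzero w) ≡ 0
  countWords-occurs-short zero _ = refl
  countWords-occurs-short (suc k) k<p = n≤0⇒n≡0 (begin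
    countWords (suc k) (occursAfterNonzero w)
      ≤⟨ countWords-occurs-suc k ⟩
    3 * countWords k (isPrefix w) + 4 * countWords k (occursAfterNonzero w)
      ≡⟨ cong₂ (λ P H → 3 * P + 4 * H) (countWords-isPrefix-short k w k<p)
               (countWords-occurs-short k (<⇒≤ k<p)) ⟩
    0 ∎)
    where open ≤-Reasoning

  countWords-occurs : (k : ℕ) →
    countWords k (occursAfterNonzero w) * 4 ^ suc p ≤ 3 * (k ∸ p) * 4 ^ k
  countWords-occurs zero = z≤n
  countWords-occurs (suc k) with p ≤? k
  ... | no p≰k rewrite countWords-occurs-short (suc k) (≰⇒> p≰k) = z≤n
  ... | yes p≤k = begin
    countWords (suc k) (occursAfterNonzero w) * (4 * 4 ^ p)
      ≤⟨ *-monoˡ-≤ (4 * 4 ^ p) (countWords-occurs-suc k) ⟩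
    (3 * P + 4 * H) * (4 * 4 ^ p)
      ≡⟨ expand P H (4 ^ p) ⟩
    12 * (P * 4 ^ p) + 4 * (H * (4 * 4 ^ p))
      ≤⟨ +-mono-≤ (*-monoʳ-≤ 12 (countWords-isPrefix k w)) (*-monoʳ-≤ 4 (countWords-occurs k)) ⟩
    12 * 4 ^ k + 4 * (3 * (k ∸ p) * 4 ^ k)
      ≡⟨ regroup (k ∸ p) (4 ^ k) ⟩
    3 * suc (k ∸ p) * (4 * 4 ^ k)
      ≡⟨ cong (λ d → 3 * d * (4 * 4 ^ k)) (+-∸-assoc 1 p≤k) ⟨
    3 * (suc k ∸ p) * (4 * 4 ^ k) ∎
    where
    open ≤-Reasoning
    P = countWords k (isPrefix w)
    H = countWords k (occursAfterNonzero w)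
    expand : ∀ P H x → (3 * P + 4 * H) * (4 * x) ≡ 12 * (P * x) + 4 * (H * (4 * x))
    expand = solve-∀
    regroup : ∀ d x → 12 * x + 4 * (3 * d * x) ≡ 3 * suc d * (4 * x)
    regroup = solve-∀

-- Every word whose minimal p-substring is w begins with w or contains w
-- right after a nonzero letter.
countMin-bound : (k p : ℕ) (w : Word p) →
  countMin k p w ≤ countWords k (isPrefix w) + countWords k (occursAfterNonzero w)
countMin-bound k p w = ≤-trans
  (count-mono _ (λ u → isPrefix w u ∨ occursAfterNonzero w u) isMinimal⇒ (allWords k))
  (count-∨ (isPrefix w) (occursAfterNonzero w) (allWords k))
  where
  isMinimal⇒ : (u : Word k) → T (eqMaybeWord (minP p u) (just w)) →
    T (isPrefix w u ∨ occursAfterNonzero w u)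
  isMinimal⇒ u t with minP-spec u w t
  ... | w∈ , w≼ = Equivalence.from T-∨ (minimalOccurrence w u w∈ w≼)

theorem3p5 : (p k : ℕ) → 2 ≤ p → p ≤ k → (w : Word p) →
    countMin k p w * 4 ^ suc p ≤ 3 * k * 4 ^ k
theorem3p5 p k 2≤p p≤k w = begin
  countMin k p w * 4 ^ suc p
    ≤⟨ *-monoˡ-≤ (4 ^ suc p) (countMin-bound k p w) ⟩
  (P + H) * (4 * 4 ^ p)
    ≡⟨ expand P H (4 ^ p) ⟩
  4 * (P * 4 ^ p) + H * 4 ^ suc p
    ≤⟨ +-mono-≤ (*-monoʳ-≤ 4 (countWords-isPrefix k w)) (countWords-occurs w k) ⟩
  4 * 4 ^ k + 3 * (k ∸ p) * 4 ^ k
    ≤⟨ +-monoˡ-≤ (3 * (k ∸ p) * 4 ^ k) (*-monoˡ-≤ (4 ^ k) four≤3p) ⟩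
  3 * p * 4 ^ k + 3 * (k ∸ p) * 4 ^ k
    ≡⟨ split p (k ∸ p) (4 ^ k) ⟨
  3 * (p + (k ∸ p)) * 4 ^ k
    ≡⟨ cong (λ n → 3 * n * 4 ^ k) (m+[n∸m]≡n p≤k) ⟩
  3 * k * 4 ^ k ∎
  where
  open ≤-Reasoning
  P = countWords k (isPrefix w)
  H = countWords k (occursAfterNonzero w)
  four≤3p : 4 ≤ 3 * p
  four≤3p = ≤-trans (m≤m+n 4 2) (*-monoʳ-≤ 3 2≤p)
  expand : ∀ P H x → (P + H) * (4 * x) ≡ 4 * (P * x) + H * (4 * x)
  expand = solve-∀
  split : ∀ a b x → 3 * (a + b) * x ≡ 3 * a * x + 3 * b * x
  split = solve-∀
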